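{- The functor $\Upsilon\vec D$ is a lax symmetric monoidal functor from $(\mathfrak M,\Box,V^{\diamond}(\{1\}))$ to $(\mathfrak R,\blacksquare,\check V^{\diamond}(\{1\}))$ (with the lax structure induced, via the adjunction $U\Upsilon^\diamond\dashv\Upsilon\vec D$, from the strong symmetric monoidal structure of $U\Upsilon^\diamond$), but it is not strong monoidal.
   Context: Multigraphs: $G=(V(G),E(G),\epsilon_G:E(G)\to\mathcal PV(G))$ with $1\le|\epsilon_G(e)|\le2$; homomorphisms $(V\phi,E\phi)$ with $\epsilon_H(E\phi(e))=V\phi[\epsilon_G(e)]$; category $\mathfrak M$. Box product: $V(G\Box H)=V(G)\times V(H)$, $E(G\Box H)=(\{1\}\times E(G)\times V(H))\cup(\{2\}\times V(G)\times E(H))$, $\epsilon(1,x,y)=\epsilon_G(x)\times\{y\}$, $\epsilon(2,x,y)=\{x\}\times\epsilon_H(y)$; unit $V^\diamond(\{1\})$: one vertex, no edges. Incidence hypergraphs: $G=(\check V(G),\check E(G),I(G),\varsigma_G,\omega_G)$ with $\varsigma_G:I(G)\to\check V(G)$, $\omega_G:I(G)\to\check E(G)$; category $\mathfrak R$. Laplacian product $G\blacksquare H$: vertices $(\{1\}\times\check V(G)\times\check V(H))\cup(\{4\}\times\check E(G)\times\check E(H))$, edges $(\{2\}\times\check E(G)\times\check V(H))\cup(\{3\}\times\check V(G)\times\check E(H))$, incidences $(\{1\}\times I(G)\times\check V(H))\cup(\{2\}\times I(G)\times\check E(H))\cup(\{3\}\times\check E(G)\times I(H))\cup(\{4\}\times\check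 V(G)\times I(H))$, $\varsigma(1,x,y)=(1,\varsigma_Gx,y)$, $\varsigma(2,x,y)=(4,\omega_Gx,y)$, $\varsigma(3,x,y)=(4,x,\omega_Hy)$, $\varsigma(4,x,y)=(1,x,\varsigma_Hy)$, $\omega(1,x,y)=(2,\omega_Gx,y)$, $\omega(2,x,y)=(3,\varsigma_Gx,y)$, $\omega(3,x,y)=(2,x,\varsigma_Hy)$, $\omega(4,x,y)=(3,x,\omega_Hy)$; unit $\check V^\diamond(\{1\})$: one vertex only. Functors: $\vec D:\mathfrak M\to$ quivers (right adjoint of undirecting): vertices $V(G)$, edges $\{(e,x,y):e\in E(G),\ \epsilon_G(e)=\{x,y\}\}$, source $(e,x,y)\mapsto x$, target $\mapsto y$. $\Upsilon$: quivers $\to\mathfrak R$, $\Upsilon(Q)=(\vec V(Q),\vec V(Q),\vec E(Q),\sigma_Q,\tau_Q)$. $U\Upsilon^\diamond:\mathfrak R\to\mathfrak M$ (bipartite incidence graph): vertices $(\{1\}\times\check V(G))\cup(\{2\}\times\check E(G))$, edges $I(G)$, $\epsilon(i)=\{(1,\varsigma_Gi),(2,\omega_Gi)\}$; it is left adjoint to $\Upsilon\vec D$ and is strong symmetric monoidal from $(\mathfrak R,\blacksquare)$ to $(\mathfrak M,\Box)$. -}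

module Defs where

open import Data.Empty using (⊥)
open import Data.Unit using (⊤; tt)
open import Data.Sum using (_⊎_; inj₁; inj₂)
open import Data.Product using (Σ; _×_; _,_; proj₁; proj₂; Σ-syntax)
open import Function.Bundles using (_⇔_; mk⇔; Equivalence)
open import Relation.Binary.PropositionalEquality
  using (_≡_; refl; sym; trans; cong; cong₂; subst)
open import Relation.Nullary using (¬_)
open import Data.Irrelevant using (Irrelevant; [_]; _>>=_)

to : {A B : Set} → A ⇔ B → A → B
to = Equivalence.to

from : {A B : Set} → A ⇔ B → B → A
from = Equivalence.from

⇔-refl : {A : Set} → A ⇔ A
⇔-refl = mk⇔ (λ a → a) (λ a → a)

⇔-sym : {A B : Set} → A ⇔ B → B ⇔ A
⇔-sym p = mk⇔ (from p) (to p)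

⇔-trans : {A B C : Set} → A ⇔ B → B ⇔ C → A ⇔ C
⇔-trans p q = mk⇔ (λ a → to q (to p a)) (λ c → from p (from q c))

Pair : {V : Set} → V → V → V → Set
Pair x y z = z ≡ x ⊎ z ≡ y

Img : {V W : Set} → (V → W) → (V → Set) → W → Set
Img {V} f P w = Σ[ v ∈ V ] (P v × f v ≡ w)

SameSet : {V : Set} → (V → Set) → (V → Set) → Set
SameSet {V} P Q = (z : V) → P z ⇔ Q z

SameSet-trans : {V : Set} {P Q R : V → Set} → SameSet P Q → SameSet Q R → SameSet P R
SameSet-trans p q z = ⇔-trans (p z) (q z)

SameSet-sym : {V : Set} {P Q : V → Set} → SameSet P Q → SameSet Q P
SameSet-sym p z = ⇔-sym (p z)

Img-cong : {V W : Set} (f : V → W) {P Q : V → Set} → SameSet P Q → SameSet (Img f P) (Img f Q)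
Img-cong f p w = mk⇔ (λ { (v , pv , e) → v , to (p v) pv , e })
                     (λ { (v , qv , e) → v , from (p v) qv , e })

Img-comp : {U V W : Set} (g : V → W) (f : U → V) (P : U → Set) →
           SameSet (Img g (Img f P)) (Img (λ u → g (f u)) P)
Img-comp g f P w =
  mk⇔ (λ { (v , (u , pu , refl) , e) → u , pu , e })
      (λ { (u , pu , e) → f u , (u , pu , refl) , e })

Img-Pair : {V W : Set} (f : V → W) (x y : V) → SameSet (Img f (Pair x y)) (Pair (f x) (f y))
Img-Pair f x y w =
  mk⇔ (λ { (v , inj₁ refl , refl) → inj₁ refl ; (v , inj₂ refl , refl) → inj₂ refl })
      (λ { (inj₁ refl) → x , inj₁ refl , refl ; (inj₂ refl) → y , inj₂ refl , refl })

Img-inv : {V W : Set} (f : V → W) (g : W → V) → (∀ w → f (g w) ≡ w) → (∀ v → g (f v) ≡ v) →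
          (P : V → Set) → SameSet (Img f P) (λ w → P (g w))
Img-inv f g fg gf P w =
  mk⇔ (λ { (v , pv , refl) → subst P (sym (gf v)) pv })
      (λ p → g w , p , fg w)

Img-id : {V : Set} (P : V → Set) → SameSet (Img (λ v → v) P) P
Img-id P w = mk⇔ (λ { (v , pv , refl) → pv }) (λ p → w , p , refl)

-- The category 𝔐 of multigraphs
-- ε G e is the subset ε_G(e) ⊆ V(G); `card` says it is of the form {x , y},
-- i.e. 1 ≤ |ε_G(e)| ≤ 2.

record Multigraph : Set₁ where
  constructor mkMG
  field
    V : Set
    E : Set
    ε : E → V → Set
    card : (e : E) → Irrelevant (Σ[ x ∈ V ] Σ[ y ∈ V ] SameSet (ε e) (Pair x y))

open Multigraph public

record MHom (G H : Multigraph) : Set where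
  constructor mkM
  field
    mV : V G → V H
    mE : E G → E H
    hom : (e : E G) → Irrelevant (SameSet (ε H (mE e)) (Img mV (ε G e)))

open MHom public

_≈M_ : {G H : Multigraph} → MHom G H → MHom G H → Set
f ≈M g = (∀ v → mV f v ≡ mV g v) × (∀ e → mE f e ≡ mE g e)

idM : (G : Multigraph) → MHom G G
idM G = record { mV = λ v → v ; mE = λ e → e ; hom = λ e → [ SameSet-sym (Img-id (ε G e)) ] }

_∘M_ : {G H K : Multigraph} → MHom H K → MHom G H → MHom G K
_∘M_ {G} {H} {K} (mkM gV gE hg) (mkM fV fE hf) = record
  { mV = λ v → gV (fV v)
  ; mE = λ e → gE (fE e)
  ; hom = λ e → hg (fE e) >>= λ h₁ → hf e >>= λ h₂ →
                 [ SameSet-trans h₁ (SameSet-trans (Img-cong gV h₂) (Img-comp gV fV (ε G e))) ]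
  }

data BoxE (G H : Multigraph) : Set where
  be₁ : E G → V H → BoxE G H
  be₂ : V G → E H → BoxE G H

boxε : (G H : Multigraph) → BoxE G H → V G × V H → Set
boxε G H (be₁ x y) (a , b) = ε G x a × b ≡ y
boxε G H (be₂ x y) (a , b) = a ≡ x × ε H y b

private
  pair-× : {A B : Set} {P : A → Set} {x y : A} (b0 : B) → SameSet P (Pair x y) →
           SameSet (λ (p : A × B) → P (proj₁ p) × proj₂ p ≡ b0) (Pair (x , b0) (y , b0))
  pair-× b0 s (a , b) =
    mk⇔ (λ { (pa , refl) → case (to (s a) pa) })
        (λ { (inj₁ refl) → from (s _) (inj₁ refl) , refl ; (inj₂ refl) → from (s _) (inj₂ refl) , refl })
    where
    case : ∀ {a x y b} → (a ≡ x ⊎ a ≡ y) → Pair (x , b) (y , b) (a , b)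
    case (inj₁ refl) = inj₁ refl
    case (inj₂ refl) = inj₂ refl

  ×-pair : {A B : Set} {P : B → Set} {x y : B} (a0 : A) → SameSet P (Pair x y) →
           SameSet (λ (p : A × B) → proj₁ p ≡ a0 × P (proj₂ p)) (Pair (a0 , x) (a0 , y))
  ×-pair a0 s (a , b) =
    mk⇔ (λ { (refl , pb) → case (to (s b) pb) })
        (λ { (inj₁ refl) → refl , from (s _) (inj₁ refl) ; (inj₂ refl) → refl , from (s _) (inj₂ refl) })
    where
    case : ∀ {a b x y} → (b ≡ x ⊎ b ≡ y) → Pair (a , x) (a , y) (a , b)
    case (inj₁ refl) = inj₁ refl
    case (inj₂ refl) = inj₂ refl

_□_ : Multigraph → Multigraph → Multigraph
G@(mkMG _ _ _ cG) □ H@(mkMG _ _ _ cH) = record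
  { V = V G × V H
  ; E = BoxE G H
  ; ε = boxε G H
  ; card = λ { (be₁ x y) → cG x >>= λ c → [ (proj₁ c , y) , (proj₁ (proj₂ c) , y) , pair-× y (proj₂ (proj₂ c)) ]
             ; (be₂ x y) → cH y >>= λ c → [ (x , proj₁ c) , (x , proj₁ (proj₂ c)) , ×-pair x (proj₂ (proj₂ c)) ] }
  }

I𝔐 : Multigraph
I𝔐 = record { V = ⊤ ; E = ⊥ ; ε = λ () ; card = λ () }

_□₁_ : {G G' H H' : Multigraph} → MHom G G' → MHom H H' → MHom (G □ H) (G' □ H')
_□₁_ {G} {G'} {H} {H'} f@(mkM _ _ hf) g@(mkM _ _ hg) = record
  { mV = λ { (a , b) → mV f a , mV g b }
  ; mE = λ { (be₁ x y) → be₁ (mE f x) (mV g y) ; (be₂ x y) → be₂ (mV f x) (mE g y) }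
  ; hom = λ { (be₁ x y) → hf x >>= λ hf → [ (λ { (a , b) →
                mk⇔ (λ { (pa , refl) → let (v , pv , e) = to (hf a) pa in (v , y) , (pv , refl) , cong (_, mV g y) e })
                    (λ { ((v , w) , (pv , refl) , refl) → from (hf _) (v , pv , refl) , refl }) }) ]
            ; (be₂ x y) → hg y >>= λ hg → [ (λ { (a , b) →
                mk⇔ (λ { (refl , pb) → let (w , pw , e) = to (hg b) pb in (x , w) , (refl , pw) , cong (mV f x ,_) e })
                    (λ { ((v , w) , (refl , pw) , refl) → refl , from (hg _) (w , pw , refl) }) }) ] }
  }

α𝔐 : (G H K : Multigraph) → MHom ((G □ H) □ K) (G □ (H □ K))
α𝔐 G H K = record
  { mV = λ p → proj₁ (proj₁ p) , (proj₂ (proj₁ p) , proj₂ p)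
  ; mE = λ { (be₁ (be₁ x b) c) → be₁ x (b , c)
           ; (be₁ (be₂ a y) c) → be₂ a (be₁ y c)
           ; (be₂ (a , b) z) → be₂ a (be₂ b z) }
  ; hom = λ e → [ SameSet-trans (lem e)
                  (SameSet-sym (Img-inv _ (λ p → (proj₁ p , proj₁ (proj₂ p)) , proj₂ (proj₂ p)) (λ _ → refl) (λ _ → refl) _)) ]
  }
  where
  lem : (e : BoxE (G □ H) K) → SameSet _ _
  lem (be₁ (be₁ x b) c) (a' , (b' , c')) =
    mk⇔ (λ { (p , refl) → (p , refl) , refl }) (λ { ((p , refl) , refl) → p , refl })
  lem (be₁ (be₂ a y) c) (a' , (b' , c')) =
    mk⇔ (λ { (refl , p , refl) → (refl , p) , refl }) (λ { ((refl , p) , refl) → refl , p , refl })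
  lem (be₂ (a , b) z) (a' , (b' , c')) =
    mk⇔ (λ { (refl , refl , p) → refl , p }) (λ { (refl , p) → refl , refl , p })

λ𝔐 : (G : Multigraph) → MHom (I𝔐 □ G) G
λ𝔐 G = record
  { mV = proj₂
  ; mE = λ { (be₁ () _) ; (be₂ tt y) → y }
  ; hom = λ { (be₁ () _) ; (be₂ tt y) → [ SameSet-trans (lem y)
                 (SameSet-sym (Img-inv proj₂ (λ z → tt , z) (λ _ → refl) (λ _ → refl) _)) ] }
  }
  where
  lem : (y : E G) → SameSet (ε G y) (λ z → tt ≡ tt × ε G y z)
  lem y z = mk⇔ (λ p → refl , p) proj₂

ρ𝔐 : (G : Multigraph) → MHom (G □ I𝔐) G
ρ𝔐 G = record
  { mV = proj₁
  ; mE = λ { (be₁ x tt) → x ; (be₂ _ ()) }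
  ; hom = λ { (be₁ x tt) → [ SameSet-trans (lem x)
                 (SameSet-sym (Img-inv proj₁ (λ z → z , tt) (λ _ → refl) (λ _ → refl) _)) ]
            ; (be₂ _ ()) }
  }
  where
  lem : (x : E G) → SameSet (ε G x) (λ z → ε G x z × tt ≡ tt)
  lem x z = mk⇔ (λ p → p , refl) proj₁

β𝔐 : (G H : Multigraph) → MHom (G □ H) (H □ G)
β𝔐 G H = record
  { mV = λ p → proj₂ p , proj₁ p
  ; mE = λ { (be₁ x y) → be₂ y x ; (be₂ x y) → be₁ y x }
  ; hom = λ e → [ SameSet-trans (lem e)
                  (SameSet-sym (Img-inv _ (λ p → proj₂ p , proj₁ p) (λ _ → refl) (λ _ → refl) _)) ]
  }
  where
  lem : (e : BoxE G H) → SameSet _ _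
  lem (be₁ x y) (b , a) = mk⇔ (λ { (p , q) → q , p }) (λ { (q , p) → p , q })
  lem (be₂ x y) (b , a) = mk⇔ (λ { (p , q) → q , p }) (λ { (q , p) → p , q })

record Hyper : Set₁ where
  field
    V̌ : Set
    Ě : Set
    Inc : Set
    ς : Inc → V̌
    ω : Inc → Ě

open Hyper public

record RHom (A B : Hyper) : Set where
  constructor mkR
  field
    rV : V̌ A → V̌ B
    rE : Ě A → Ě B
    rI : Inc A → Inc B
    ς-comm : (i : Inc A) → Irrelevant (ς B (rI i) ≡ rV (ς A i))
    ω-comm : (i : Inc A) → Irrelevant (ω B (rI i) ≡ rE (ω A i))

open RHom public

_≈R_ : {A B : Hyper} → RHom A B → RHom A B → Set
f ≈R g = (∀ v → rV f v ≡ rV g v) × (∀ e → rE f e ≡ rE g e) × (∀ i → rI f i ≡ rI g i)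

idR : (A : Hyper) → RHom A A
idR A = record { rV = λ v → v ; rE = λ e → e ; rI = λ i → i ; ς-comm = λ _ → [ refl ] ; ω-comm = λ _ → [ refl ] }

_∘R_ : {A B C : Hyper} → RHom B C → RHom A B → RHom A C
g@(mkR _ _ _ gς gω) ∘R f@(mkR _ _ _ fς fω) = record
  { rV = λ v → rV g (rV f v) ; rE = λ e → rE g (rE f e) ; rI = λ i → rI g (rI f i)
  ; ς-comm = λ i → gς (rI f i) >>= λ p → fς i >>= λ q → [ trans p (cong (rV g) q) ]
  ; ω-comm = λ i → gω (rI f i) >>= λ p → fω i >>= λ q → [ trans p (cong (rE g) q) ] }

IsIsoR : {A B : Hyper} → RHom A B → Set
IsIsoR {A} {B} f = Σ[ g ∈ RHom B A ] ((g ∘R f) ≈R idR A × (f ∘R g) ≈R idR B)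

data LV (A B : Hyper) : Set where
  lv₁ : V̌ A → V̌ B → LV A B
  lv₄ : Ě A → Ě B → LV A B

data LE (A B : Hyper) : Set where
  le₂ : Ě A → V̌ B → LE A B
  le₃ : V̌ A → Ě B → LE A B

data LI (A B : Hyper) : Set where
  li₁ : Inc A → V̌ B → LI A B
  li₂ : Inc A → Ě B → LI A B
  li₃ : Ě A → Inc B → LI A B
  li₄ : V̌ A → Inc B → LI A B

_■_ : Hyper → Hyper → Hyper
A ■ B = record
  { V̌ = LV A B ; Ě = LE A B ; Inc = LI A B
  ; ς = λ { (li₁ x y) → lv₁ (ς A x) y ; (li₂ x y) → lv₄ (ω A x) y
          ; (li₃ x y) → lv₄ x (ω B y) ; (li₄ x y) → lv₁ x (ς B y) }
  ; ω = λ { (li₁ x y) → le₂ (ω A x) y ; (li₂ x y) → le₃ (ς A x) y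
          ; (li₃ x y) → le₂ x (ς B y) ; (li₄ x y) → le₃ x (ω B y) }
  }

Iℜ : Hyper
Iℜ = record { V̌ = ⊤ ; Ě = ⊥ ; Inc = ⊥ ; ς = λ () ; ω = λ () }

_■₁_ : {A A' B B' : Hyper} → RHom A A' → RHom B B' → RHom (A ■ B) (A' ■ B')
f@(mkR _ _ _ fς fω) ■₁ g@(mkR _ _ _ gς gω) = record
  { rV = λ { (lv₁ x y) → lv₁ (rV f x) (rV g y) ; (lv₄ x y) → lv₄ (rE f x) (rE g y) }
  ; rE = λ { (le₂ x y) → le₂ (rE f x) (rV g y) ; (le₃ x y) → le₃ (rV f x) (rE g y) }
  ; rI = λ { (li₁ x y) → li₁ (rI f x) (rV g y) ; (li₂ x y) → li₂ (rI f x) (rE g y)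
           ; (li₃ x y) → li₃ (rE f x) (rI g y) ; (li₄ x y) → li₄ (rV f x) (rI g y) }
  ; ς-comm = λ { (li₁ x y) → fς x >>= λ p → [ cong (λ t → lv₁ t _) p ]
               ; (li₂ x y) → fω x >>= λ p → [ cong (λ t → lv₄ t _) p ]
               ; (li₃ x y) → gω y >>= λ p → [ cong (λ t → lv₄ _ t) p ]
               ; (li₄ x y) → gς y >>= λ p → [ cong (λ t → lv₁ _ t) p ] }
  ; ω-comm = λ { (li₁ x y) → fω x >>= λ p → [ cong (λ t → le₂ t _) p ]
               ; (li₂ x y) → fς x >>= λ p → [ cong (λ t → le₃ t _) p ]
               ; (li₃ x y) → gς y >>= λ p → [ cong (λ t → le₂ _ t) p ]
               ; (li₄ x y) → gω y >>= λ p → [ cong (λ t → le₃ _ t) p ] }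
  }

αℜ : (A B C : Hyper) → RHom ((A ■ B) ■ C) (A ■ (B ■ C))
αℜ A B C = record
  { rV = λ { (lv₁ (lv₁ a b) c) → lv₁ a (lv₁ b c)
           ; (lv₁ (lv₄ e f) c) → lv₄ e (le₂ f c)
           ; (lv₄ (le₂ e b) h) → lv₄ e (le₃ b h)
           ; (lv₄ (le₃ a f) h) → lv₁ a (lv₄ f h) }
  ; rE = λ { (le₂ (le₂ e b) c) → le₂ e (lv₁ b c)
           ; (le₂ (le₃ a f) c) → le₃ a (le₂ f c)
           ; (le₃ (lv₁ a b) h) → le₃ a (le₃ b h)
           ; (le₃ (lv₄ e f) h) → le₂ e (lv₄ f h) }
  ; rI = λ { (li₁ (li₁ x b) c) → li₁ x (lv₁ b c)
           ; (li₁ (li₂ x f) c) → li₂ x (le₂ f c)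
           ; (li₁ (li₃ e y) c) → li₃ e (li₁ y c)
           ; (li₁ (li₄ a y) c) → li₄ a (li₁ y c)
           ; (li₂ (li₁ x b) h) → li₂ x (le₃ b h)
           ; (li₂ (li₂ x f) h) → li₁ x (lv₄ f h)
           ; (li₂ (li₃ e y) h) → li₃ e (li₂ y h)
           ; (li₂ (li₄ a y) h) → li₄ a (li₂ y h)
           ; (li₃ (le₂ e b) z) → li₃ e (li₄ b z)
           ; (li₃ (le₃ a f) z) → li₄ a (li₃ f z)
           ; (li₄ (lv₁ a b) z) → li₄ a (li₄ b z)
           ; (li₄ (lv₄ e f) z) → li₃ e (li₃ f z) }
  ; ς-comm = λ { (li₁ (li₁ x b) c) → [ refl ] ; (li₁ (li₂ x f) c) → [ refl ]
               ; (li₁ (li₃ e y) c) → [ refl ] ; (li₁ (li₄ a y) c) → [ refl ]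
               ; (li₂ (li₁ x b) h) → [ refl ] ; (li₂ (li₂ x f) h) → [ refl ]
               ; (li₂ (li₃ e y) h) → [ refl ] ; (li₂ (li₄ a y) h) → [ refl ]
               ; (li₃ (le₂ e b) z) → [ refl ] ; (li₃ (le₃ a f) z) → [ refl ]
               ; (li₄ (lv₁ a b) z) → [ refl ] ; (li₄ (lv₄ e f) z) → [ refl ] }
  ; ω-comm = λ { (li₁ (li₁ x b) c) → [ refl ] ; (li₁ (li₂ x f) c) → [ refl ]
               ; (li₁ (li₃ e y) c) → [ refl ] ; (li₁ (li₄ a y) c) → [ refl ]
               ; (li₂ (li₁ x b) h) → [ refl ] ; (li₂ (li₂ x f) h) → [ refl ]
               ; (li₂ (li₃ e y) h) → [ refl ] ; (li₂ (li₄ a y) h) → [ refl ]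
               ; (li₃ (le₂ e b) z) → [ refl ] ; (li₃ (le₃ a f) z) → [ refl ]
               ; (li₄ (lv₁ a b) z) → [ refl ] ; (li₄ (lv₄ e f) z) → [ refl ] }
  }

λℜ : (A : Hyper) → RHom (Iℜ ■ A) A
λℜ A = record
  { rV = λ { (lv₁ tt a) → a ; (lv₄ () _) }
  ; rE = λ { (le₂ () _) ; (le₃ tt f) → f }
  ; rI = λ { (li₁ () _) ; (li₂ () _) ; (li₃ () _) ; (li₄ tt j) → j }
  ; ς-comm = λ { (li₁ () _) ; (li₂ () _) ; (li₃ () _) ; (li₄ tt j) → [ refl ] }
  ; ω-comm = λ { (li₁ () _) ; (li₂ () _) ; (li₃ () _) ; (li₄ tt j) → [ refl ] }
  }

ρℜ : (A : Hyper) → RHom (A ■ Iℜ) A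
ρℜ A = record
  { rV = λ { (lv₁ a tt) → a ; (lv₄ _ ()) }
  ; rE = λ { (le₂ e tt) → e ; (le₃ _ ()) }
  ; rI = λ { (li₁ i tt) → i ; (li₂ _ ()) ; (li₃ _ ()) ; (li₄ _ ()) }
  ; ς-comm = λ { (li₁ i tt) → [ refl ] ; (li₂ _ ()) ; (li₃ _ ()) ; (li₄ _ ()) }
  ; ω-comm = λ { (li₁ i tt) → [ refl ] ; (li₂ _ ()) ; (li₃ _ ()) ; (li₄ _ ()) }
  }

βℜ : (A B : Hyper) → RHom (A ■ B) (B ■ A)
βℜ A B = record
  { rV = λ { (lv₁ a b) → lv₁ b a ; (lv₄ e f) → lv₄ f e }
  ; rE = λ { (le₂ e b) → le₃ b e ; (le₃ a f) → le₂ f a }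
  ; rI = λ { (li₁ i b) → li₄ b i ; (li₂ i f) → li₃ f i ; (li₃ e j) → li₂ j e ; (li₄ a j) → li₁ j a }
  ; ς-comm = λ { (li₁ i b) → [ refl ] ; (li₂ i f) → [ refl ] ; (li₃ e j) → [ refl ] ; (li₄ a j) → [ refl ] }
  ; ω-comm = λ { (li₁ i b) → [ refl ] ; (li₂ i f) → [ refl ] ; (li₃ e j) → [ refl ] ; (li₄ a j) → [ refl ] }
  }

-- directed edges (e , x , y) of D⃗(G) with ε_G(e) = {x , y}
record DEdge (G : Multigraph) : Set where
  constructor dedge
  field
    de : E G
    dx : V G
    dy : V G
    ok : Irrelevant (SameSet (ε G de) (Pair dx dy))

open DEdge public

ΥD : Multigraph → Hyper
ΥD G = record { V̌ = V G ; Ě = V G ; Inc = DEdge G ; ς = dx ; ω = dy }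

ΥD₁ : {G H : Multigraph} → MHom G H → RHom (ΥD G) (ΥD H)
ΥD₁ {G} {H} f@(mkM fV fE hf) = record
  { rV = fV ; rE = fV
  ; rI = λ { (dedge e x y o) → dedge (fE e) (fV x) (fV y)
                 (hf e >>= λ h → o >>= λ o' →
                   [ SameSet-trans h (SameSet-trans (Img-cong fV o') (Img-Pair fV x y)) ]) }
  ; ς-comm = λ _ → [ refl ] ; ω-comm = λ _ → [ refl ] }

UΥ : Hyper → Multigraph
UΥ A = record
  { V = V̌ A ⊎ Ě A ; E = Inc A
  ; ε = λ i → Pair (inj₁ (ς A i)) (inj₂ (ω A i))
  ; card = λ i → [ inj₁ (ς A i) , inj₂ (ω A i) , (λ _ → ⇔-refl) ] }

η : (A : Hyper) → RHom A (ΥD (UΥ A))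
η A = record
  { rV = inj₁ ; rE = inj₂
  ; rI = λ i → dedge i (inj₁ (ς A i)) (inj₂ (ω A i)) [ (λ _ → ⇔-refl) ]
  ; ς-comm = λ _ → [ refl ] ; ω-comm = λ _ → [ refl ] }

counit : (G : Multigraph) → MHom (UΥ (ΥD G)) G
counit G = record
  { mV = λ { (inj₁ v) → v ; (inj₂ v) → v }
  ; mE = de
  ; hom = λ { (dedge e x y o) → o >>= λ o' → [ SameSet-trans o' (SameSet-sym (Img-Pair _ (inj₁ x) (inj₂ y))) ] } }

-- inverse of the strong monoidal structure map UΥ⋄A □ UΥ⋄B ≅ UΥ⋄(A ■ B)
φ⁻¹ : (A B : Hyper) → MHom (UΥ (A ■ B)) (UΥ A □ UΥ B)
φ⁻¹ A B = record
  { mV = fv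
  ; mE = λ { (li₁ i w) → be₁ i (inj₁ w) ; (li₂ i f) → be₁ i (inj₂ f)
           ; (li₃ e j) → be₂ (inj₂ e) j ; (li₄ v j) → be₂ (inj₁ v) j }
  ; hom = λ i → [ SameSet-trans (lem i) (SameSet-sym (Img-Pair fv _ _)) ]
  }
  where
  fv : V̌ (A ■ B) ⊎ Ě (A ■ B) → (V̌ A ⊎ Ě A) × (V̌ B ⊎ Ě B)
  fv (inj₁ (lv₁ v w)) = inj₁ v , inj₁ w
  fv (inj₁ (lv₄ e f)) = inj₂ e , inj₂ f
  fv (inj₂ (le₂ e w)) = inj₂ e , inj₁ w
  fv (inj₂ (le₃ v f)) = inj₁ v , inj₂ f
  swap⇔ : {X : Set} {P Q : X → Set} → SameSet (λ z → P z ⊎ Q z) (λ z → Q z ⊎ P z)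
  swap⇔ z = mk⇔ (λ { (inj₁ p) → inj₂ p ; (inj₂ q) → inj₁ q }) (λ { (inj₁ p) → inj₂ p ; (inj₂ q) → inj₁ q })
  lem : (i : LI A B) → SameSet _ _
  lem (li₁ i w) = pair-× (inj₁ w) (λ _ → ⇔-refl)
  lem (li₂ i f) = SameSet-trans (pair-× (inj₂ f) (λ _ → ⇔-refl)) swap⇔
  lem (li₃ e j) = SameSet-trans (×-pair (inj₂ e) (λ _ → ⇔-refl)) swap⇔
  lem (li₄ v j) = ×-pair (inj₁ v) (λ _ → ⇔-refl)

-- inverse of the strong monoidal unit map V⋄({1}) ≅ UΥ⋄(V̌⋄({1}))
φ₀⁻¹ : MHom (UΥ Iℜ) I𝔐
φ₀⁻¹ = record
  { mV = λ _ → tt ; mE = λ () ; hom = λ () }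

-- The lax structure on ΥD⃗ induced by the adjunction UΥ⋄ ⊣ ΥD⃗ from the
-- strong monoidal structure of UΥ⋄ (mates):
--   μ_{G,H} = ΥD⃗((ε_G □ ε_H) ∘ φ⁻¹_{ΥD⃗G,ΥD⃗H}) ∘ η_{ΥD⃗G ■ ΥD⃗H}
--   μ₀      = ΥD⃗(φ₀⁻¹) ∘ η_{V̌⋄({1})}

μ : (G H : Multigraph) → RHom (ΥD G ■ ΥD H) (ΥD (G □ H))
μ G H = ΥD₁ ((counit G □₁ counit H) ∘M φ⁻¹ (ΥD G) (ΥD H)) ∘R η (ΥD G ■ ΥD H)

μ₀ : RHom Iℜ (ΥD I𝔐)
μ₀ = ΥD₁ φ₀⁻¹ ∘R η Iℜ

record IsLaxSymmetricMonoidalΥD : Set₁ where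
  field
    F-resp : {G H : Multigraph} {f g : MHom G H} → f ≈M g → ΥD₁ f ≈R ΥD₁ g
    F-id   : (G : Multigraph) → ΥD₁ (idM G) ≈R idR (ΥD G)
    F-comp : {G H K : Multigraph} (g : MHom H K) (f : MHom G H) →
             ΥD₁ (g ∘M f) ≈R (ΥD₁ g ∘R ΥD₁ f)
    μ-natural : {G G' H H' : Multigraph} (f : MHom G G') (g : MHom H H') →
                (μ G' H' ∘R (ΥD₁ f ■₁ ΥD₁ g)) ≈R (ΥD₁ (f □₁ g) ∘R μ G H)
    μ-assoc : (G H K : Multigraph) →
              (ΥD₁ (α𝔐 G H K) ∘R (μ (G □ H) K ∘R (μ G H ■₁ idR (ΥD K))))
                ≈R (μ G (H □ K) ∘R ((idR (ΥD G) ■₁ μ H K) ∘R αℜ (ΥD G) (ΥD H) (ΥD K)))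
    μ-left-unit : (G : Multigraph) →
                  (ΥD₁ (λ𝔐 G) ∘R (μ I𝔐 G ∘R (μ₀ ■₁ idR (ΥD G)))) ≈R λℜ (ΥD G)
    μ-right-unit : (G : Multigraph) →
                   (ΥD₁ (ρ𝔐 G) ∘R (μ G I𝔐 ∘R (idR (ΥD G) ■₁ μ₀))) ≈R ρℜ (ΥD G)
    μ-symmetric : (G H : Multigraph) →
                  (ΥD₁ (β𝔐 G H) ∘R μ G H) ≈R (μ H G ∘R βℜ (ΥD G) (ΥD H))

IsStrongΥD : Set₁
IsStrongΥD = IsIsoR μ₀ × ((G H : Multigraph) → IsIsoR (μ G H))

-- ΥD⃗ G carries V(G) both as its vertices and as its edges, and the directed
-- edges of G as its incidences; so the mate μ_{G,H} sends each of the four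
-- summands of ΥD⃗G ■ ΥD⃗H to the evident pair of V(G □ H), resp. directed edge
-- of G □ H, and every coherence law holds on the nose, by computation, once
-- the summand is known. The structure is not strong already at the unit:
-- ΥD⃗ turns the vertex of V⋄({1}) into an edge, whereas V̌⋄({1}) has none.
module Submission where

open import Defs
open import Data.Product using (_×_; _,_)
open import Data.Unit using (tt)
open import Relation.Nullary using (¬_)
open import Relation.Binary.PropositionalEquality using (_≡_; refl)
open import Data.Irrelevant using (Irrelevant)

dedge-cong : {G : Multigraph} {e e' : E G} {x x' y y' : V G} →
             e ≡ e' → x ≡ x' → y ≡ y' →
             (o : Irrelevant (SameSet (ε G e) (Pair x y)))
             (o' : Irrelevant (SameSet (ε G e') (Pair x' y'))) →
             _≡_ {A = DEdge G} (dedge e x y o) (dedge e' x' y' o')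
dedge-cong refl refl refl _ _ = refl

ΥD₁-resp-≈ : {G H : Multigraph} {f g : MHom G H} → f ≈M g → ΥD₁ f ≈R ΥD₁ g
ΥD₁-resp-≈ {H = H} (f≈gV , f≈gE) =
  f≈gV , f≈gV ,
  λ { (dedge e x y _) → dedge-cong {H} (f≈gE e) (f≈gV x) (f≈gV y) _ _ }

ΥD₁-id : (G : Multigraph) → ΥD₁ (idM G) ≈R idR (ΥD G)
ΥD₁-id G = (λ _ → refl) , (λ _ → refl) , (λ _ → refl)

ΥD₁-∘ : {G H K : Multigraph} (g : MHom H K) (f : MHom G H) →
        ΥD₁ (g ∘M f) ≈R (ΥD₁ g ∘R ΥD₁ f)
ΥD₁-∘ g f = (λ _ → refl) , (λ _ → refl) , (λ _ → refl)

μ-natural : {G G' H H' : Multigraph} (f : MHom G G') (g : MHom H H') →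
            (μ G' H' ∘R (ΥD₁ f ■₁ ΥD₁ g)) ≈R (ΥD₁ (f □₁ g) ∘R μ G H)
μ-natural f g =
  (λ { (lv₁ _ _) → refl ; (lv₄ _ _) → refl }) ,
  (λ { (le₂ _ _) → refl ; (le₃ _ _) → refl }) ,
  (λ { (li₁ _ _) → refl ; (li₂ _ _) → refl ; (li₃ _ _) → refl ; (li₄ _ _) → refl })

μ-assoc : (G H K : Multigraph) →
          (ΥD₁ (α𝔐 G H K) ∘R (μ (G □ H) K ∘R (μ G H ■₁ idR (ΥD K))))
            ≈R (μ G (H □ K) ∘R ((idR (ΥD G) ■₁ μ H K) ∘R αℜ (ΥD G) (ΥD H) (ΥD K)))
μ-assoc G H K =
  (λ { (lv₁ (lv₁ _ _) _) → refl ; (lv₁ (lv₄ _ _) _) → refl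
     ; (lv₄ (le₂ _ _) _) → refl ; (lv₄ (le₃ _ _) _) → refl }) ,
  (λ { (le₂ (le₂ _ _) _) → refl ; (le₂ (le₃ _ _) _) → refl
     ; (le₃ (lv₁ _ _) _) → refl ; (le₃ (lv₄ _ _) _) → refl }) ,
  (λ { (li₁ (li₁ _ _) _) → refl ; (li₁ (li₂ _ _) _) → refl
     ; (li₁ (li₃ _ _) _) → refl ; (li₁ (li₄ _ _) _) → refl
     ; (li₂ (li₁ _ _) _) → refl ; (li₂ (li₂ _ _) _) → refl
     ; (li₂ (li₃ _ _) _) → refl ; (li₂ (li₄ _ _) _) → refl
     ; (li₃ (le₂ _ _) _) → refl ; (li₃ (le₃ _ _) _) → refl
     ; (li₄ (lv₁ _ _) _) → refl ; (li₄ (lv₄ _ _) _) → refl })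

μ-left-unit : (G : Multigraph) →
              (ΥD₁ (λ𝔐 G) ∘R (μ I𝔐 G ∘R (μ₀ ■₁ idR (ΥD G)))) ≈R λℜ (ΥD G)
μ-left-unit G =
  (λ { (lv₁ tt _) → refl ; (lv₄ () _) }) ,
  (λ { (le₂ () _) ; (le₃ tt _) → refl }) ,
  (λ { (li₁ () _) ; (li₂ () _) ; (li₃ () _) ; (li₄ tt _) → refl })

μ-right-unit : (G : Multigraph) →
               (ΥD₁ (ρ𝔐 G) ∘R (μ G I𝔐 ∘R (idR (ΥD G) ■₁ μ₀))) ≈R ρℜ (ΥD G)
μ-right-unit G =
  (λ { (lv₁ _ tt) → refl ; (lv₄ _ ()) }) ,
  (λ { (le₂ _ tt) → refl ; (le₃ _ ()) }) ,
  (λ { (li₁ _ tt) → refl ; (li₂ _ ()) ; (li₃ _ ()) ; (li₄ _ ()) })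

μ-symmetric : (G H : Multigraph) →
              (ΥD₁ (β𝔐 G H) ∘R μ G H) ≈R (μ H G ∘R βℜ (ΥD G) (ΥD H))
μ-symmetric G H =
  (λ { (lv₁ _ _) → refl ; (lv₄ _ _) → refl }) ,
  (λ { (le₂ _ _) → refl ; (le₃ _ _) → refl }) ,
  (λ { (li₁ _ _) → refl ; (li₂ _ _) → refl ; (li₃ _ _) → refl ; (li₄ _ _) → refl })

ΥD-lax-symmetric-monoidal : IsLaxSymmetricMonoidalΥD
ΥD-lax-symmetric-monoidal = record
  { F-resp       = λ {G} {H} {f} {g} → ΥD₁-resp-≈ {G} {H} {f} {g}
  ; F-id         = ΥD₁-id
  ; F-comp       = ΥD₁-∘
  ; μ-natural    = μ-natural
  ; μ-assoc      = μ-assoc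
  ; μ-left-unit  = μ-left-unit
  ; μ-right-unit = μ-right-unit
  ; μ-symmetric  = μ-symmetric
  }

μ₀-not-iso : ¬ IsIsoR μ₀
μ₀-not-iso (μ₀⁻¹ , _) = rE μ₀⁻¹ tt

mainTheorem8 : IsLaxSymmetricMonoidalΥD × ¬ IsStrongΥD
mainTheorem8 = ΥD-lax-symmetric-monoidal , λ (μ₀-iso , _) → μ₀-not-iso μ₀-iso
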